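{- Let $m,n\in\mathbb{N}$ and $k,\ell\in\mathbb{N}_0$. The number of non-attacking mixed placements of $k$ rooks and $\ell$ files on the rectangle board $R_{m,n}$ is $$|\mathcal{M}_{k,\ell}(R_{m,n})|=\sum_{\pi\in\mathcal{C}_k(m)}\ \sum_{\rho\in\mathcal{WC}_{k+1}(\ell\,\|\,\pi)}k!\binom{n}{k}\prod_{j=1}^{k+1}\binom{m_j(\pi)}{\rho_j}(n+1-j)^{\rho_j}.$$
   Context: $R_{m,n}$ is the board with $m$ columns each of height $n$ (the board of the word $X^mY^n$); its columns are numbered $1,\dots,m$ from right to left. $\mathcal{M}_{k,\ell}(B)$ is the set of placements of $k$ rooks and $\ell$ files in distinct cells of $B$ such that no two rooks share a row or column, no two files share a column, no file and rook share a column, and no file lies in the same row as a rook and to its left. $\mathcal{C}_k(m)$ is the set of $k$-element subsets $\pi=\{\pi_1<\pi_2<\cdots<\pi_k\}$ of $\{1,\dots,m\}$. For such $\pi$ set $m_1(\pi)=\pi_1-1$, $m_j(\pi)=\pi_j-\pi_{j-1}-1$ for $2\le j\le k$, and $m_{k+1}(\pi)=m-\pi_k$ (for $k=0$, $\pi$ is empty and $m_1(\pi)=m$). $\mathcal{WC}_{k+1}(\ell\,\|\,\pi)$ is the set of $\rho=(\rho_1,\dots,\rho_{k+1})\in\mathbb{N}_0^{k+1}$ with $\rho_1+\cdots+\rho_{k+1}=\ell$ and $\rho_j\le m_j(\pi)$ for all $j$. -}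

module Defs where

open import Data.Nat using (ℕ; zero; suc; _+_; _*_; _∸_; _^_; _≡ᵇ_; _<ᵇ_)
open import Data.Nat.Combinatorics using (_C_)
open import Data.Nat.Base using (_!)
open import Data.Bool using (Bool; true; false; _∧_; _∨_; not; if_then_else_)
open import Data.List using (List; []; _∷_; _++_; map; concatMap; filter; length; upTo; foldr)
open import Data.Nat.ListAction using (sum)
import Data.List as L
open import Data.Vec using (Vec; []; _∷_; lookup; toList)
open import Data.Fin using (Fin; toℕ; _≟_)
open import Data.Fin.Properties using () renaming (_≟_ to _≟F_)
open import Data.List using (allFin)
open import Relation.Nullary.Decidable using (⌊_⌋)

data Cell : Set where
  empty rook file : Cell

isRook : Cell → Bool
isRook rook = true
isRook _    = false

isFile : Cell → Bool
isFile file = true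
isFile _    = false

-- A configuration on R_{m,n}: for each of the m columns a column of n cells.
-- Column index c : Fin m stands for column number toℕ c + 1 (columns are
-- numbered 1..m from RIGHT to LEFT, so a larger index is further left).
Grid : ℕ → ℕ → Set
Grid m n = Vec (Vec Cell n) m

cell : ∀ {m n} → Grid m n → Fin m → Fin n → Cell
cell g c r = lookup (lookup g c) r

allVecs : {A : Set} → List A → (n : ℕ) → List (Vec A n)
allVecs xs zero    = [] ∷ []
allVecs xs (suc n) = concatMap (λ x → map (x ∷_) (allVecs xs n)) xs

allGrids : (m n : ℕ) → List (Grid m n)
allGrids m n = allVecs (allVecs (empty ∷ rook ∷ file ∷ []) n) m

allB : {A : Set} → List A → (A → Bool) → Bool
allB xs p = foldr (λ x b → p x ∧ b) true xs

eqF : ∀ {k} → Fin k → Fin k → Bool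
eqF a b = ⌊ a ≟F b ⌋

pairOK : ∀ {m n} → Grid m n → Fin m → Fin n → Fin m → Fin n → Bool
pairOK g c r c' r' =
  let x = cell g c r ; y = cell g c' r'
      sameCol = eqF c c' ; sameRow = eqF r r'
  in not (isRook x ∧ isRook y ∧ (sameRow ∨ sameCol))
   ∧ not (isFile x ∧ isFile y ∧ sameCol)
   ∧ not (isFile x ∧ isRook y ∧ sameCol)
   ∧ not (isFile x ∧ isRook y ∧ sameRow ∧ (toℕ c' <ᵇ toℕ c))

nonAttacking : ∀ {m n} → Grid m n → Bool
nonAttacking {m} {n} g =
  allB (allFin m) λ c → allB (allFin n) λ r →
  allB (allFin m) λ c' → allB (allFin n) λ r' →
    (eqF c c' ∧ eqF r r') ∨ pairOK g c r c' r'

countCells : ∀ {m n} → (Cell → Bool) → Grid m n → ℕ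
countCells p g = length (filter (λ x → Data.Bool._≟_ (p x) true)
                          (L.concat (toList (Data.Vec.map toList g))))

inM : ∀ {m n} → ℕ → ℕ → Grid m n → Bool
inM k ℓ g = nonAttacking g ∧ (countCells isRook g ≡ᵇ k) ∧ (countCells isFile g ≡ᵇ ℓ)

numM : (k ℓ m n : ℕ) → ℕ
numM k ℓ m n = length (filter (λ g → Data.Bool._≟_ (inM k ℓ g) true) (allGrids m n))

choose : List ℕ → ℕ → List (List ℕ)
choose xs       zero    = [] ∷ []
choose []       (suc k) = []
choose (x ∷ xs) (suc k) = map (x ∷_) (choose xs k) ++ choose xs (suc k)

Ck : ℕ → ℕ → List (List ℕ)
Ck k m = choose (map suc (upTo m)) k

-- (m_1(π), ..., m_{k+1}(π)) with m_1 = π_1 - 1, m_j = π_j - π_{j-1} - 1,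
-- m_{k+1} = m - π_k  (and m_1 = m when π is empty)
gapsFrom : ℕ → ℕ → List ℕ → List ℕ
gapsFrom m prev []       = (m ∸ prev) ∷ []
gapsFrom m prev (p ∷ ps) = (p ∸ prev ∸ 1) ∷ gapsFrom m p ps

gaps : ℕ → List ℕ → List ℕ
gaps m π = gapsFrom m 0 π

boundedTuples : List ℕ → List (List ℕ)
boundedTuples []       = [] ∷ []
boundedTuples (b ∷ bs) = concatMap (λ r → map (r ∷_) (boundedTuples bs)) (upTo (suc b))

WC : ℕ → ℕ → List ℕ → List (List ℕ)
WC m ℓ π = filter (λ ρ → Data.Nat._≟_ (sum ρ) ℓ) (boundedTuples (gaps m π))

prodTerm : ℕ → ℕ → List ℕ → List ℕ → ℕ
prodTerm n j (g ∷ gs) (r ∷ rs) = (g C r) * ((n + 1 ∸ j) ^ r) * prodTerm n (suc j) gs rs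
prodTerm n j _        _        = 1

rhs : (k ℓ m n : ℕ) → ℕ
rhs k ℓ m n =
  sum (map (λ π → sum (map (λ ρ → (k !) * (n C k) * prodTerm n 1 (gaps m π) ρ)
                           (WC m ℓ π)))
           (Ck k m))

{-# OPTIONS --safe #-}

-- Both sides satisfy the same recurrence in the number of columns, obtained by peeling
-- off the rightmost column (column 1).
--
-- Scanning the columns from the right, a configuration is non-attacking iff every column
-- holds at most one piece, in a row not taken by a rook further right (a file may lie to
-- the right of a rook in its row, never to its left). With i rows taken, column 1 is
-- empty, or holds a rook or a file in one of the n − i free rows, which gives a three-term
-- recurrence.
--
-- On the right-hand side (generalised to i taken rows: factor k! C(n − i, k), gaps
-- numbered from i + 1) split on whether 1 ∈ π. If so, m₁ = 0 and what remains is the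
-- same sum on one column fewer with one more taken row, since
-- k! C(n − i, k) = (n − i) (k − 1)! C(n − i − 1, k − 1). If not, Pascal's rule
-- C(m₁, ρ₁) = C(m₁ − 1, ρ₁) + C(m₁ − 1, ρ₁ − 1) splits the sum into the empty-column
-- term and the file term, whose weight is n + 1 − (i + 1) = n − i.

module Submission where

open import Defs
open import Data.Bool using (Bool; true; false; _∧_; _∨_; not; if_then_else_)
open import Data.Bool.Properties using (∧-assoc; ∧-zeroʳ)
import Data.Bool as Bool
open import Data.Empty using (⊥-elim)
open import Data.Fin using (Fin; zero; suc)
open import Data.Fin.Properties using () renaming (_≟_ to _≟ᶠ_)
open import Data.Fin.Subset using (Subset; _∪_; _∈_; ∣_∣; ⊥)
open import Data.Fin.Subset.Properties using (x∈p∪q⁻; p⊆p∪q; q⊆p∪q; ∉⊥; ∣p∣≤n; ∣⊥∣≡0; ∪-identityʳ)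
open import Data.List using (List; []; _∷_; _++_; map; concatMap; filter; length; upTo; applyUpTo; _∷ʳ_; tabulate)
open import Data.List.Properties using (map-++; map-∘; map-upTo; upTo-∷ʳ; filter-++; length-++)
open import Data.List.Relation.Unary.All as All using (All; []; _∷_)
open import Data.List.Relation.Unary.All.Properties using (++⁺; gmap⁺)
open import Data.Nat using (ℕ; zero; suc; _+_; _*_; _∸_; _^_; _≤_; _<_; z<s; pred; _!; _≡ᵇ_)
open import Data.Nat.Combinatorics using (_C_; nCk+nC[k+1]≡[n+1]C[k+1]; nC1≡n; k>n⇒nCk≡0)
open import Data.Nat.ListAction using (sum)
open import Data.Nat.ListAction.Properties using (sum-++)
open import Data.Nat.Properties
open import Data.Nat.Tactic.RingSolver using (solve-∀)
open import Data.Product using (_×_; _,_; proj₁; proj₂)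
open import Data.Sum using (_⊎_; inj₁; inj₂; [_,_]′)
open import Data.Vec using (Vec; []; _∷_; lookup; toList; replicate; here; there)
import Data.Vec as Vec
open import Data.Vec.Properties using (lookup-map; lookup⇒[]=; []=⇒lookup; map-replicate)
open import Function using (_∘_; id)
open import Relation.Nullary using (¬_; Dec; does; yes; no)
open import Relation.Binary.PropositionalEquality

private variable
  A B : Set
  m n : ℕ

-- Sums over lists

⟦_⟧ : Bool → ℕ
⟦ true  ⟧ = 1
⟦ false ⟧ = 0

⟦∧⟧ : ∀ a b → ⟦ a ∧ b ⟧ ≡ ⟦ a ⟧ * ⟦ b ⟧
⟦∧⟧ true  b = sym (*-identityˡ ⟦ b ⟧)
⟦∧⟧ false b = refl

∑ : List A → (A → ℕ) → ℕ
∑ xs f = sum (map f xs)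

infix 5 ∑
syntax ∑ xs (λ x → e) = ∑[ x ∈ xs ] e

length-filter≡∑ : (p : A → Bool) (xs : List A) →
                  length (filter (λ x → p x Bool.≟ true) xs) ≡ ∑[ x ∈ xs ] ⟦ p x ⟧
length-filter≡∑ p []       = refl
length-filter≡∑ p (x ∷ xs) with p x
... | true  = cong suc (length-filter≡∑ p xs)
... | false = length-filter≡∑ p xs

∑-cong : ∀ {f g : A → ℕ} → (∀ x → f x ≡ g x) → ∀ xs → ∑ xs f ≡ ∑ xs g
∑-cong f≗g []       = refl
∑-cong f≗g (x ∷ xs) = cong₂ _+_ (f≗g x) (∑-cong f≗g xs)

∑-congᴬ : ∀ {f g : A → ℕ} {xs} → All (λ x → f x ≡ g x) xs → ∑ xs f ≡ ∑ xs g
∑-congᴬ []         = refl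
∑-congᴬ (fx≡gx ∷ eqs) = cong₂ _+_ fx≡gx (∑-congᴬ eqs)

∑-++ : ∀ xs ys (f : A → ℕ) → ∑ (xs ++ ys) f ≡ ∑ xs f + ∑ ys f
∑-++ xs ys f = trans (cong sum (map-++ f xs ys)) (sum-++ (map f xs) (map f ys))

∑-map : ∀ (g : A → B) xs (f : B → ℕ) → ∑ (map g xs) f ≡ ∑ xs (f ∘ g)
∑-map g xs f = cong sum (sym (map-∘ xs))

∑-concatMap : ∀ (g : A → List B) xs (f : B → ℕ) →
              ∑ (concatMap g xs) f ≡ ∑[ x ∈ xs ] ∑ (g x) f
∑-concatMap g []       f = refl
∑-concatMap g (x ∷ xs) f = trans (∑-++ (g x) (concatMap g xs) f) (cong (∑ (g x) f +_) (∑-concatMap g xs f))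

∑-zero : ∀ (xs : List A) → ∑[ x ∈ xs ] 0 ≡ 0
∑-zero []       = refl
∑-zero (x ∷ xs) = ∑-zero xs

∑-+ : ∀ xs (f g : A → ℕ) → ∑[ x ∈ xs ] (f x + g x) ≡ ∑ xs f + ∑ xs g
∑-+ []       f g = refl
∑-+ (x ∷ xs) f g rewrite ∑-+ xs f g = +-exchange (f x) (g x) (∑ xs f) (∑ xs g)
  where
  +-exchange : ∀ a b c d → a + b + (c + d) ≡ a + c + (b + d)
  +-exchange = solve-∀

∑-*ˡ : ∀ c xs (f : A → ℕ) → ∑[ x ∈ xs ] (c * f x) ≡ c * ∑ xs f
∑-*ˡ c []       f = sym (*-zeroʳ c)
∑-*ˡ c (x ∷ xs) f rewrite ∑-*ˡ c xs f = sym (*-distribˡ-+ c (f x) (∑ xs f))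

∑-filter : ∀ {P : A → Set} (P? : ∀ x → Dec (P x)) xs (f : A → ℕ) →
           ∑ (filter P? xs) f ≡ ∑[ x ∈ xs ] (if does (P? x) then f x else 0)
∑-filter P? []       f = refl
∑-filter P? (x ∷ xs) f with does (P? x)
... | true  = cong (f x +_) (∑-filter P? xs f)
... | false = ∑-filter P? xs f

∑-upTo-suc : ∀ N (f : ℕ → ℕ) → ∑ (upTo (suc N)) f ≡ f 0 + (∑[ r ∈ upTo N ] f (suc r))
∑-upTo-suc N f = cong (f 0 +_) (trans (cong (λ rs → ∑ rs f) (sym (map-upTo suc N))) (∑-map suc (upTo N) f))

∑-upTo-∷ʳ : ∀ N (f : ℕ → ℕ) → ∑ (upTo (suc N)) f ≡ ∑ (upTo N) f + f N
∑-upTo-∷ʳ N f = begin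
  ∑ (upTo (suc N)) f        ≡⟨ cong (λ rs → ∑ rs f) (upTo-∷ʳ N) ⟨
  ∑ (upTo N ∷ʳ N) f         ≡⟨ ∑-++ (upTo N) (N ∷ []) f ⟩
  ∑ (upTo N) f + (f N + 0)  ≡⟨ cong (∑ (upTo N) f +_) (+-identityʳ (f N)) ⟩
  ∑ (upTo N) f + f N        ∎
  where open ≡-Reasoning

-- Non-attacking configurations, column by column

∧-true⁻ : ∀ {a b} → (a ∧ b) ≡ true → a ≡ true × b ≡ true
∧-true⁻ {true} {true} _ = refl , refl

∧-true⁺ : ∀ {a b} → a ≡ true → b ≡ true → (a ∧ b) ≡ true
∧-true⁺ refl refl = refl

true⇔true⇒≡ : ∀ {a b} → (a ≡ true → b ≡ true) → (b ≡ true → a ≡ true) → a ≡ b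
true⇔true⇒≡ {true}  {b}     a⇒b _   = sym (a⇒b refl)
true⇔true⇒≡ {false} {true}  _   b⇒a = b⇒a refl
true⇔true⇒≡ {false} {false} _   _   = refl

allB-tabulate⁻ : ∀ {k} (f : Fin k → A) (p : A → Bool) →
                 allB (tabulate f) p ≡ true → ∀ i → p (f i) ≡ true
allB-tabulate⁻ f p h zero    = proj₁ (∧-true⁻ h)
allB-tabulate⁻ f p h (suc i) = allB-tabulate⁻ (f ∘ suc) p (proj₂ (∧-true⁻ h)) i

allB-tabulate⁺ : ∀ {k} (f : Fin k → A) (p : A → Bool) →
                 (∀ i → p (f i) ≡ true) → allB (tabulate f) p ≡ true
allB-tabulate⁺ {k = zero}  f p each = refl
allB-tabulate⁺ {k = suc k} f p each = ∧-true⁺ (each zero) (allB-tabulate⁺ (f ∘ suc) p (each ∘ suc))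

eqF-refl : ∀ {k} (r : Fin k) → eqF r r ≡ true
eqF-refl r with r ≟ᶠ r
... | yes _   = refl
... | no r≢r = ⊥-elim (r≢r refl)

eqF-≢ : ∀ {k} {r r′ : Fin k} → ¬ r ≡ r′ → eqF r r′ ≡ false
eqF-≢ {r = r} {r′} r≢r′ with r ≟ᶠ r′
... | yes r≡r′ = ⊥-elim (r≢r′ r≡r′)
... | no _     = refl

eqF⇒≡ : ∀ {k} {r r′ : Fin k} → eqF r r′ ≡ true → r ≡ r′
eqF⇒≡ {r = r} {r′} eq with r ≟ᶠ r′
... | yes r≡r′ = r≡r′

eqF-suc : ∀ {k} (c c′ : Fin k) → eqF (suc c) (suc c′) ≡ eqF c c′
eqF-suc c c′ with c ≟ᶠ c′
... | yes _ = refl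
... | no _  = refl

-- pairOK g c r c′ r′ unfolds to cellsOK (cell g c r) (cell g c′ r′) (eqF c c′) (eqF r r′) (toℕ c′ <ᵇ toℕ c).
cellsOK : Cell → Cell → Bool → Bool → Bool → Bool
cellsOK x y sameCol sameRow leftOf =
    not (isRook x ∧ isRook y ∧ (sameRow ∨ sameCol))
  ∧ not (isFile x ∧ isFile y ∧ sameCol)
  ∧ not (isFile x ∧ isRook y ∧ sameCol)
  ∧ not (isFile x ∧ isRook y ∧ sameRow ∧ leftOf)

cellsOK-sameColumn⁺ : ∀ {x y} → x ≡ empty ⊎ y ≡ empty → cellsOK x y true false false ≡ true
cellsOK-sameColumn⁺         (inj₁ refl) = refl
cellsOK-sameColumn⁺ {empty} (inj₂ refl) = refl
cellsOK-sameColumn⁺ {rook}  (inj₂ refl) = refl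
cellsOK-sameColumn⁺ {file}  (inj₂ refl) = refl

cellsOK-sameColumn⁻ : ∀ x y → cellsOK x y true false false ≡ true → cellsOK y x true false false ≡ true →
                      x ≡ empty ⊎ y ≡ empty
cellsOK-sameColumn⁻ empty y     _  _  = inj₁ refl
cellsOK-sameColumn⁻ rook  empty _  _  = inj₂ refl
cellsOK-sameColumn⁻ file  empty _  _  = inj₂ refl
cellsOK-sameColumn⁻ rook  rook  () _
cellsOK-sameColumn⁻ rook  file  _  ()
cellsOK-sameColumn⁻ file  rook  () _
cellsOK-sameColumn⁻ file  file  () _

cellsOK-rightOf : ∀ x y sameRow → (x ≡ rook → sameRow ≡ true → y ≡ empty) →
                  cellsOK x y false sameRow false ≡ true
cellsOK-rightOf empty y     _     _ = refl
cellsOK-rightOf rook  empty _     _ = refl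
cellsOK-rightOf rook  rook  false _ = refl
cellsOK-rightOf rook  rook  true  h with () ← h refl refl
cellsOK-rightOf rook  file  _     _ = refl
cellsOK-rightOf file  empty _     _ = refl
cellsOK-rightOf file  rook  false _ = refl
cellsOK-rightOf file  rook  true  _ = refl
cellsOK-rightOf file  file  _     _ = refl

cellsOK-leftOf : ∀ x y sameRow → (y ≡ rook → sameRow ≡ true → x ≡ empty) →
                 cellsOK x y false sameRow true ≡ true
cellsOK-leftOf empty y     _     _ = refl
cellsOK-leftOf rook  empty _     _ = refl
cellsOK-leftOf rook  rook  false _ = refl
cellsOK-leftOf rook  rook  true  h with () ← h refl refl
cellsOK-leftOf rook  file  _     _ = refl
cellsOK-leftOf file  empty _     _ = refl
cellsOK-leftOf file  rook  false _ = refl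
cellsOK-leftOf file  rook  true  h with () ← h refl refl
cellsOK-leftOf file  file  _     _ = refl

cellsOK-rookRow : ∀ {x} y → x ≡ rook → cellsOK x y false true false ≡ true → cellsOK y x false true true ≡ true →
                  y ≡ empty
cellsOK-rookRow empty refl _  _  = refl
cellsOK-rookRow rook  refl () _
cellsOK-rookRow file  refl _  ()

isEmptyColumn : Vec Cell n → Bool
isEmptyColumn []          = true
isEmptyColumn (empty ∷ c) = isEmptyColumn c
isEmptyColumn (rook  ∷ c) = false
isEmptyColumn (file  ∷ c) = false

columnOK : Subset n → Vec Cell n → Bool
columnOK []      []          = true
columnOK (s ∷ S) (empty ∷ c) = columnOK S c
columnOK (s ∷ S) (rook  ∷ c) = not s ∧ isEmptyColumn c
columnOK (s ∷ S) (file  ∷ c) = not s ∧ isEmptyColumn c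

rookRows : Vec Cell n → Subset n
rookRows = Vec.map isRook

-- Columns are scanned from the right; S holds the rows of the rooks already scanned.
admissible : Subset n → Grid m n → Bool
admissible S []      = true
admissible S (c ∷ g) = columnOK S c ∧ admissible (S ∪ rookRows c) g

AvoidsRows : Subset n → Vec Cell n → Set
AvoidsRows S c = ∀ r → r ∈ S → lookup c r ≡ empty

AtMostOneOccupied : Vec Cell n → Set
AtMostOneOccupied c = ∀ r r′ → ¬ r ≡ r′ → lookup c r ≡ empty ⊎ lookup c r′ ≡ empty

isEmptyColumn⁻ : (c : Vec Cell n) → isEmptyColumn c ≡ true → ∀ r → lookup c r ≡ empty
isEmptyColumn⁻ (empty ∷ c) h zero    = refl
isEmptyColumn⁻ (empty ∷ c) h (suc r) = isEmptyColumn⁻ c h r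

isEmptyColumn⁺ : (c : Vec Cell n) → (∀ r → lookup c r ≡ empty) → isEmptyColumn c ≡ true
isEmptyColumn⁺ []          h = refl
isEmptyColumn⁺ (empty ∷ c) h = isEmptyColumn⁺ c (h ∘ suc)
isEmptyColumn⁺ (rook  ∷ c) h with () ← h zero
isEmptyColumn⁺ (file  ∷ c) h with () ← h zero

atMostOneOccupied-∷ : ∀ {x} (c : Vec Cell n) → isEmptyColumn c ≡ true → AtMostOneOccupied (x ∷ c)
atMostOneOccupied-∷ c h zero    zero     0≢0 = ⊥-elim (0≢0 refl)
atMostOneOccupied-∷ c h zero    (suc r′) _   = inj₂ (isEmptyColumn⁻ c h r′)
atMostOneOccupied-∷ c h (suc r) _        _   = inj₁ (isEmptyColumn⁻ c h r)

columnOK⁻ : ∀ (S : Subset n) c → columnOK S c ≡ true → AvoidsRows S c × AtMostOneOccupied c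
columnOK⁻ []          []          h = (λ ()) , (λ ())
columnOK⁻ (s ∷ S)     (empty ∷ c) h = avoids , single
  where
  avoids : AvoidsRows (s ∷ S) (empty ∷ c)
  avoids zero    _            = refl
  avoids (suc r) (there r∈S) = proj₁ (columnOK⁻ S c h) r r∈S
  single : AtMostOneOccupied (empty ∷ c)
  single zero    _        _    = inj₁ refl
  single (suc r) zero     _    = inj₂ refl
  single (suc r) (suc r′) r≢r′ = proj₂ (columnOK⁻ S c h) r r′ (r≢r′ ∘ cong suc)
columnOK⁻ (false ∷ S) (rook ∷ c) h =
  (λ { (suc r) (there _) → isEmptyColumn⁻ c h r }) , atMostOneOccupied-∷ c h
columnOK⁻ (false ∷ S) (file ∷ c) h =
  (λ { (suc r) (there _) → isEmptyColumn⁻ c h r }) , atMostOneOccupied-∷ c h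

columnOK⁺ : ∀ (S : Subset n) c → AvoidsRows S c → AtMostOneOccupied c → columnOK S c ≡ true
columnOK⁺ []      []          avoids single = refl
columnOK⁺ (s ∷ S) (empty ∷ c) avoids single =
  columnOK⁺ S c (λ r r∈S → avoids (suc r) (there r∈S)) (λ r r′ r≢r′ → single (suc r) (suc r′) (λ { refl → r≢r′ refl }))
columnOK⁺ (true  ∷ S) (rook ∷ c) avoids single with () ← avoids zero here
columnOK⁺ (false ∷ S) (rook ∷ c) avoids single =
  isEmptyColumn⁺ c λ r → [ (λ ()) , id ]′ (single zero (suc r) λ ())
columnOK⁺ (true  ∷ S) (file ∷ c) avoids single with () ← avoids zero here
columnOK⁺ (false ∷ S) (file ∷ c) avoids single =
  isEmptyColumn⁺ c λ r → [ (λ ()) , id ]′ (single zero (suc r) λ ())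

NonAttacking : Grid m n → Set
NonAttacking g = ∀ c r c′ r′ → ((eqF c c′ ∧ eqF r r′) ∨ pairOK g c r c′ r′) ≡ true

Avoids : Subset n → Grid m n → Set
Avoids S g = ∀ c r → r ∈ S → cell g c r ≡ empty

nonAttacking⁻ : (g : Grid m n) → nonAttacking g ≡ true → NonAttacking g
nonAttacking⁻ g h c r c′ r′ =
  allB-tabulate⁻ id _ (allB-tabulate⁻ id _ (allB-tabulate⁻ id _ (allB-tabulate⁻ id _ h c) r) c′) r′

nonAttacking⁺ : (g : Grid m n) → NonAttacking g → nonAttacking g ≡ true
nonAttacking⁺ g h =
  allB-tabulate⁺ id _ λ c → allB-tabulate⁺ id _ λ r → allB-tabulate⁺ id _ λ c′ → allB-tabulate⁺ id _ λ r′ → h c r c′ r′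

∈rookRows⁺ : ∀ (c : Vec Cell n) {r} → lookup c r ≡ rook → r ∈ rookRows c
∈rookRows⁺ c {r} c[r]≡rook = lookup⇒[]= r (rookRows c) (trans (lookup-map r isRook c) (cong isRook c[r]≡rook))

∈rookRows⁻ : ∀ (c : Vec Cell n) {r} → r ∈ rookRows c → lookup c r ≡ rook
∈rookRows⁻ c {r} r∈R = isRook⁻ (lookup c r) (trans (sym (lookup-map r isRook c)) ([]=⇒lookup r∈R))
  where
  isRook⁻ : ∀ x → isRook x ≡ true → x ≡ rook
  isRook⁻ rook _ = refl

admissible⁻ : ∀ (S : Subset n) (g : Grid m n) → admissible S g ≡ true → NonAttacking g × Avoids S g
admissible⁻ S []        h = (λ ()) , (λ ())
admissible⁻ S (col ∷ g) h = pairs , avoids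
  where
  colOK = columnOK⁻ S col (proj₁ (∧-true⁻ h))
  rest  = admissible⁻ (S ∪ rookRows col) g (proj₂ (∧-true⁻ h))

  blocked : ∀ {r r′} c′ → lookup col r ≡ rook → r ≡ r′ → cell g c′ r′ ≡ empty
  blocked c′ c[r]≡rook refl = proj₂ rest c′ _ (q⊆p∪q S (rookRows col) (∈rookRows⁺ col c[r]≡rook))

  pairs : NonAttacking (col ∷ g)
  pairs zero r zero r′ with r ≟ᶠ r′
  ... | yes refl = refl
  ... | no r≢r′  = cellsOK-sameColumn⁺ (proj₂ colOK r r′ r≢r′)
  pairs zero r (suc c′) r′ =
    cellsOK-rightOf _ _ (eqF r r′) λ c[r]≡rook r≡r′ → blocked c′ c[r]≡rook (eqF⇒≡ r≡r′)
  pairs (suc c) r zero r′ =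
    cellsOK-leftOf _ _ (eqF r r′) λ c[r′]≡rook r≡r′ → blocked c c[r′]≡rook (sym (eqF⇒≡ r≡r′))
  pairs (suc c) r (suc c′) r′ rewrite eqF-suc c c′ = proj₁ rest c r c′ r′

  avoids : Avoids S (col ∷ g)
  avoids zero    r r∈S = proj₁ colOK r r∈S
  avoids (suc c) r r∈S = proj₂ rest c r (p⊆p∪q (rookRows col) r∈S)

admissible⁺ : ∀ (S : Subset n) (g : Grid m n) → NonAttacking g → Avoids S g → admissible S g ≡ true
admissible⁺ S []        _     _      = refl
admissible⁺ S (col ∷ g) pairs avoids =
  ∧-true⁺ (columnOK⁺ S col (avoids zero) single) (admissible⁺ (S ∪ rookRows col) g pairs′ avoids′)
  where
  sameColumn : ∀ r r′ → ¬ r ≡ r′ → cellsOK (lookup col r) (lookup col r′) true false false ≡ true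
  sameColumn r r′ r≢r′ =
    subst (λ b → (b ∨ cellsOK (lookup col r) (lookup col r′) true b false) ≡ true) (eqF-≢ r≢r′) (pairs zero r zero r′)

  single : AtMostOneOccupied col
  single r r′ r≢r′ = cellsOK-sameColumn⁻ _ _ (sameColumn r r′ r≢r′) (sameColumn r′ r (r≢r′ ∘ sym))

  pairs′ : NonAttacking g
  pairs′ c r c′ r′ rewrite sym (eqF-suc c c′) = pairs (suc c) r (suc c′) r′

  avoids′ : Avoids (S ∪ rookRows col) g
  avoids′ c r r∈S′ with x∈p∪q⁻ S (rookRows col) r∈S′
  ... | inj₁ r∈S = avoids (suc c) r r∈S
  ... | inj₂ r∈R = cellsOK-rookRow (cell g c r) (∈rookRows⁻ col r∈R) rightward leftward
    where
    rightward : cellsOK (lookup col r) (cell g c r) false true false ≡ true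
    rightward = subst (λ b → cellsOK (lookup col r) (cell g c r) false b false ≡ true) (eqF-refl r) (pairs zero r (suc c) r)
    leftward : cellsOK (cell g c r) (lookup col r) false true true ≡ true
    leftward = subst (λ b → cellsOK (cell g c r) (lookup col r) false b true ≡ true) (eqF-refl r) (pairs (suc c) r zero r)

nonAttacking≡admissible : (g : Grid m n) → nonAttacking g ≡ admissible ⊥ g
nonAttacking≡admissible g = true⇔true⇒≡
  (λ h → admissible⁺ ⊥ g (nonAttacking⁻ g h) (λ _ _ r∈⊥ → ⊥-elim (∉⊥ r∈⊥)))
  (λ h → nonAttacking⁺ g (proj₁ (admissible⁻ ⊥ g h)))

-- Counting configurations column by column

cells : List Cell
cells = empty ∷ rook ∷ file ∷ []

∑-allVecs-suc : ∀ (xs : List A) n (f : Vec A (suc n) → ℕ) →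
                ∑ (allVecs xs (suc n)) f ≡ ∑[ x ∈ xs ] ∑[ v ∈ allVecs xs n ] f (x ∷ v)
∑-allVecs-suc xs n f = trans (∑-concatMap _ xs f) (∑-cong (λ x → ∑-map (x ∷_) (allVecs xs n) f) xs)

columnCount : (Cell → Bool) → Vec Cell n → ℕ
columnCount p c = length (filter (λ x → p x Bool.≟ true) (toList c))

countCells-∷ : ∀ p (c : Vec Cell n) (g : Grid m n) → countCells p (c ∷ g) ≡ columnCount p c + countCells p g
countCells-∷ p c g = trans (cong length (filter-++ (λ x → p x Bool.≟ true) (toList c) _)) (length-++ (filter _ (toList c)))

columnCount-emptyColumn : ∀ n p → p empty ≡ false → columnCount p (replicate n empty) ≡ 0
columnCount-emptyColumn zero    p _     = refl
columnCount-emptyColumn (suc n) p empty∉p rewrite empty∉p = columnCount-emptyColumn n p empty∉p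

∑-emptyColumn : ∀ n (K : Vec Cell n → ℕ) → ∑[ c ∈ allVecs cells n ] ⟦ isEmptyColumn c ⟧ * K c ≡ K (replicate n empty)
∑-emptyColumn zero    K = trans (+-identityʳ _) (+-identityʳ _)
∑-emptyColumn (suc n) K = begin
  ∑ (allVecs cells (suc n)) (λ c → ⟦ isEmptyColumn c ⟧ * K c)
    ≡⟨ ∑-allVecs-suc cells n _ ⟩
  ∑ L (λ c → ⟦ isEmptyColumn c ⟧ * K (empty ∷ c)) + (∑ L (λ _ → 0) + (∑ L (λ _ → 0) + 0))
    ≡⟨ cong₂ (λ a b → a + (b + (b + 0))) (∑-emptyColumn n (λ c → K (empty ∷ c))) (∑-zero L) ⟩
  K (replicate (suc n) empty) + 0
    ≡⟨ +-identityʳ _ ⟩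
  K (replicate (suc n) empty) ∎
  where
  open ≡-Reasoning
  L = allVecs cells n

emptyColumn-statistics : ∀ (S : Subset n) (K : ℕ → ℕ → ℕ → ℕ) →
  K (∣ S ∪ rookRows (replicate n empty) ∣) (columnCount isRook (replicate n empty)) (columnCount isFile (replicate n empty))
  ≡ K (∣ S ∣) 0 0
emptyColumn-statistics {n} S K
  rewrite map-replicate isRook empty n | ∪-identityʳ S
        | columnCount-emptyColumn n isRook refl | columnCount-emptyColumn n isFile refl = refl

-- An admissible column is empty, or holds a single rook or file in one of the n ∸ ∣ S ∣ free rows.
∑-columns : ∀ n (S : Subset n) (H : ℕ → ℕ → ℕ → ℕ) →
  ∑[ c ∈ allVecs cells n ] ⟦ columnOK S c ⟧ * H (∣ S ∪ rookRows c ∣) (columnCount isRook c) (columnCount isFile c)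
  ≡ H (∣ S ∣) 0 0 + (n ∸ ∣ S ∣) * H (suc ∣ S ∣) 1 0 + (n ∸ ∣ S ∣) * H (∣ S ∣) 0 1
∑-columns zero    []          H = refl
∑-columns (suc n) (true ∷ S)  H = begin
  ∑ (allVecs cells (suc n)) _
    ≡⟨ ∑-allVecs-suc cells n _ ⟩
  ∑ L (λ c → ⟦ columnOK S c ⟧ * H (suc ∣ S ∪ rookRows c ∣) (columnCount isRook c) (columnCount isFile c))
    + (∑ L (λ _ → 0) + (∑ L (λ _ → 0) + 0))
    ≡⟨ cong₂ (λ a b → a + (b + (b + 0))) (∑-columns n S (λ x → H (suc x))) (∑-zero L) ⟩
  _ + 0
    ≡⟨ +-identityʳ _ ⟩
  _ ∎
  where
  open ≡-Reasoning
  L = allVecs cells n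
∑-columns (suc n) (false ∷ S) H = begin
  ∑ (allVecs cells (suc n)) _
    ≡⟨ ∑-allVecs-suc cells n _ ⟩
  ∑ L (λ c → ⟦ columnOK S c ⟧ * H (∣ S ∪ rookRows c ∣) (columnCount isRook c) (columnCount isFile c))
    + (∑ L (λ c → ⟦ isEmptyColumn c ⟧ * H (suc ∣ S ∪ rookRows c ∣) (suc (columnCount isRook c)) (columnCount isFile c))
    + (∑ L (λ c → ⟦ isEmptyColumn c ⟧ * H (∣ S ∪ rookRows c ∣) (columnCount isRook c) (suc (columnCount isFile c))) + 0))
    ≡⟨ cong₂ _+_ (∑-columns n S H)
         (cong₂ (λ a b → a + (b + 0)) (∑-emptyColumn n _) (∑-emptyColumn n _)) ⟩
  H s 0 0 + (n ∸ s) * H (suc s) 1 0 + (n ∸ s) * H s 0 1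
    + (H (suc (∣ S ∪ rookRows E ∣)) (suc (columnCount isRook E)) (columnCount isFile E)
    + (H (∣ S ∪ rookRows E ∣) (columnCount isRook E) (suc (columnCount isFile E)) + 0))
    ≡⟨ cong₂ (λ a b → H s 0 0 + (n ∸ s) * H (suc s) 1 0 + (n ∸ s) * H s 0 1 + (a + (b + 0)))
         (emptyColumn-statistics S (λ x r f → H (suc x) (suc r) f))
         (emptyColumn-statistics S (λ x r f → H x r (suc f))) ⟩
  H s 0 0 + (n ∸ s) * H (suc s) 1 0 + (n ∸ s) * H s 0 1 + (H (suc s) 1 0 + (H s 0 1 + 0))
    ≡⟨ one-more-row (H s 0 0) (H (suc s) 1 0) (H s 0 1) (n ∸ s) ⟩
  H s 0 0 + suc (n ∸ s) * H (suc s) 1 0 + suc (n ∸ s) * H s 0 1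
    ≡⟨ cong (λ f → H s 0 0 + f * H (suc s) 1 0 + f * H s 0 1) (sym (+-∸-assoc 1 (∣p∣≤n S))) ⟩
  H s 0 0 + (suc n ∸ s) * H (suc s) 1 0 + (suc n ∸ s) * H s 0 1 ∎
  where
  open ≡-Reasoning
  L = allVecs cells n
  s = ∣ S ∣
  E = replicate n empty
  one-more-row : ∀ a b c f → a + f * b + f * c + (b + (c + 0)) ≡ a + suc f * b + suc f * c
  one-more-row = solve-∀

shift : ℕ → (ℕ → ℕ) → ℕ → ℕ
shift zero    f k       = f k
shift (suc p) f zero    = 0
shift (suc p) f (suc k) = shift p f k

shift-cong : ∀ {f g : ℕ → ℕ} → (∀ k → f k ≡ g k) → ∀ p k → shift p f k ≡ shift p g k
shift-cong f≗g zero    k       = f≗g k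
shift-cong f≗g (suc p) zero    = refl
shift-cong f≗g (suc p) (suc k) = shift-cong f≗g p k

*-shift : ∀ c (f : ℕ → ℕ) p ℓ → c * shift p f ℓ ≡ shift p (λ ℓ′ → c * f ℓ′) ℓ
*-shift c f zero    ℓ       = refl
*-shift c f (suc p) zero    = *-zeroʳ c
*-shift c f (suc p) (suc ℓ) = *-shift c f p ℓ

∑-shift : ∀ (xs : List A) (F : A → ℕ → ℕ) p ℓ → ∑[ x ∈ xs ] shift p (F x) ℓ ≡ shift p (λ ℓ′ → ∑[ x ∈ xs ] F x ℓ′) ℓ
∑-shift xs F zero    ℓ       = refl
∑-shift xs F (suc p) zero    = ∑-zero xs
∑-shift xs F (suc p) (suc ℓ) = ∑-shift xs F p ℓ

-- placements n m i k ℓ counts the placements of k rooks and ℓ files in m columns of height n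
-- when i rows are already blocked by rooks further to the right.
placements : (n m i k ℓ : ℕ) → ℕ
placements n zero    i k ℓ = ⟦ (0 ≡ᵇ k) ∧ (0 ≡ᵇ ℓ) ⟧
placements n (suc m) i k ℓ =
  placements n m i k ℓ
  + (n ∸ i) * shift 1 (λ k′ → placements n m (suc i) k′ ℓ) k
  + (n ∸ i) * shift 1 (placements n m i k) ℓ

placed : Subset n → (p q k ℓ : ℕ) → Grid m n → Bool
placed S p q k ℓ g = admissible S g ∧ (p + countCells isRook g ≡ᵇ k) ∧ (q + countCells isFile g ≡ᵇ ℓ)

placed-∷ : ∀ (S : Subset n) k ℓ c (g : Grid m n) →
  placed S 0 0 k ℓ (c ∷ g) ≡ columnOK S c ∧ placed (S ∪ rookRows c) (columnCount isRook c) (columnCount isFile c) k ℓ g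
placed-∷ S k ℓ c g rewrite countCells-∷ isRook c g | countCells-∷ isFile c g = ∧-assoc (columnOK S c) _ _

∑-placed-offset : ∀ (gs : List (Grid m n)) S p q k ℓ →
  ∑[ g ∈ gs ] ⟦ placed S p q k ℓ g ⟧ ≡ shift p (λ k′ → shift q (λ ℓ′ → ∑[ g ∈ gs ] ⟦ placed S 0 0 k′ ℓ′ g ⟧) ℓ) k
∑-placed-offset gs S zero    zero    k       ℓ       = refl
∑-placed-offset gs S zero    (suc q) k       zero    =
  trans (∑-cong (λ g → cong ⟦_⟧ (trans (cong (admissible S g ∧_) (∧-zeroʳ _)) (∧-zeroʳ _))) gs) (∑-zero gs)
∑-placed-offset gs S zero    (suc q) k       (suc ℓ) = ∑-placed-offset gs S zero q k ℓ
∑-placed-offset gs S (suc p) q       zero    ℓ       = trans (∑-cong (λ g → cong ⟦_⟧ (∧-zeroʳ (admissible S g))) gs) (∑-zero gs)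
∑-placed-offset gs S (suc p) q       (suc k) ℓ       = ∑-placed-offset gs S p q k ℓ

∑-placed≡placements : ∀ m (S : Subset n) k ℓ → ∑[ g ∈ allVecs (allVecs cells n) m ] ⟦ placed S 0 0 k ℓ g ⟧ ≡ placements n m ∣ S ∣ k ℓ
∑-placed≡placements zero    S k ℓ = +-identityʳ _
∑-placed≡placements {n} (suc m) S k ℓ = begin
  ∑ (allVecs columns (suc m)) (λ g → ⟦ placed S 0 0 k ℓ g ⟧)
    ≡⟨ ∑-allVecs-suc columns m _ ⟩
  ∑[ c ∈ columns ] ∑[ g ∈ grids ] ⟦ placed S 0 0 k ℓ (c ∷ g) ⟧
    ≡⟨ ∑-cong (λ c → trans (∑-cong (λ g → trans (cong ⟦_⟧ (placed-∷ S k ℓ c g)) (⟦∧⟧ (columnOK S c) _)) grids)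
                            (∑-*ˡ ⟦ columnOK S c ⟧ grids _)) columns ⟩
  ∑[ c ∈ columns ] ⟦ columnOK S c ⟧ * (∑[ g ∈ grids ] ⟦ placed (S ∪ rookRows c) (columnCount isRook c) (columnCount isFile c) k ℓ g ⟧)
    ≡⟨ ∑-cong (λ c → cong (⟦ columnOK S c ⟧ *_) (rest c)) columns ⟩
  ∑[ c ∈ columns ] ⟦ columnOK S c ⟧ * H (∣ S ∪ rookRows c ∣) (columnCount isRook c) (columnCount isFile c)
    ≡⟨ ∑-columns n S H ⟩
  placements n (suc m) ∣ S ∣ k ℓ ∎
  where
  open ≡-Reasoning
  columns = allVecs cells n
  grids   = allVecs columns m
  H : ℕ → ℕ → ℕ → ℕ
  H x p q = shift p (λ k′ → shift q (placements n m x k′) ℓ) k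
  rest : ∀ c → ∑[ g ∈ grids ] ⟦ placed (S ∪ rookRows c) (columnCount isRook c) (columnCount isFile c) k ℓ g ⟧
             ≡ H (∣ S ∪ rookRows c ∣) (columnCount isRook c) (columnCount isFile c)
  rest c = trans (∑-placed-offset grids (S ∪ rookRows c) (columnCount isRook c) (columnCount isFile c) k ℓ)
                 (shift-cong (λ k′ → shift-cong (∑-placed≡placements m (S ∪ rookRows c) k′) (columnCount isFile c) ℓ)
                             (columnCount isRook c) k)

numM≡placements : ∀ k ℓ m n → numM k ℓ m n ≡ placements n m 0 k ℓ
numM≡placements k ℓ m n = begin
  numM k ℓ m n
    ≡⟨ length-filter≡∑ (inM k ℓ) (allGrids m n) ⟩
  ∑[ g ∈ allGrids m n ] ⟦ inM k ℓ g ⟧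
    ≡⟨ ∑-cong (λ g → cong (λ b → ⟦ b ∧ (countCells isRook g ≡ᵇ k) ∧ (countCells isFile g ≡ᵇ ℓ) ⟧) (nonAttacking≡admissible g)) (allGrids m n) ⟩
  ∑[ g ∈ allGrids m n ] ⟦ placed ⊥ 0 0 k ℓ g ⟧
    ≡⟨ ∑-placed≡placements m ⊥ k ℓ ⟩
  placements n m ∣ ⊥ {n} ∣ k ℓ
    ≡⟨ cong (λ i → placements n m i k ℓ) (∣⊥∣≡0 n) ⟩
  placements n m 0 k ℓ ∎
  where open ≡-Reasoning

-- The right-hand side satisfies the same recurrence

[k+1]*[n+1]C[k+1]≡[n+1]*nCk : ∀ n k → suc k * (suc n C suc k) ≡ suc n * (n C k)
[k+1]*[n+1]C[k+1]≡[n+1]*nCk n       zero    = trans (+-identityʳ _) (trans (nC1≡n (suc n)) (sym (*-identityʳ _)))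
[k+1]*[n+1]C[k+1]≡[n+1]*nCk zero    (suc k) = *-zeroʳ (suc (suc k))
[k+1]*[n+1]C[k+1]≡[n+1]*nCk (suc n) (suc k) = begin
  suc (suc k) * (suc (suc n) C suc (suc k))
    ≡⟨ cong (suc (suc k) *_) (nCk+nC[k+1]≡[n+1]C[k+1] (suc n) (suc k)) ⟨
  suc (suc k) * (a + b)
    ≡⟨ distrib a b k ⟩
  a + suc k * a + suc (suc k) * b
    ≡⟨ cong₂ (λ x y → a + x + y) ([k+1]*[n+1]C[k+1]≡[n+1]*nCk n k) ([k+1]*[n+1]C[k+1]≡[n+1]*nCk n (suc k)) ⟩
  a + suc n * (n C k) + suc n * (n C suc k)
    ≡⟨ collect a (suc n) (n C k) (n C suc k) ⟩
  a + suc n * (n C k + n C suc k)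
    ≡⟨ cong (λ x → a + suc n * x) (nCk+nC[k+1]≡[n+1]C[k+1] n k) ⟩
  suc (suc n) * a ∎
  where
  open ≡-Reasoning
  a = suc n C suc k
  b = suc n C suc (suc k)
  distrib : ∀ a b k → suc (suc k) * (a + b) ≡ a + suc k * a + suc (suc k) * b
  distrib = solve-∀
  collect : ∀ a m x y → a + m * x + m * y ≡ a + m * (x + y)
  collect = solve-∀

[k+1]!*nC[k+1]≡n*k!*[n∸1]Ck : ∀ n k → suc k ! * (n C suc k) ≡ n * (k ! * (pred n C k))
[k+1]!*nC[k+1]≡n*k!*[n∸1]Ck zero    k = *-zeroʳ (suc k !)
[k+1]!*nC[k+1]≡n*k!*[n∸1]Ck (suc n) k = begin
  suc k * k ! * (suc n C suc k)   ≡⟨ x*y*z≡y*[x*z] (suc k) (k !) _ ⟩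
  k ! * (suc k * (suc n C suc k)) ≡⟨ cong (k ! *_) ([k+1]*[n+1]C[k+1]≡[n+1]*nCk n k) ⟩
  k ! * (suc n * (n C k))         ≡⟨ x*[y*z]≡y*[x*z] (k !) (suc n) _ ⟩
  suc n * (k ! * (n C k))         ∎
  where
  open ≡-Reasoning
  x*y*z≡y*[x*z] : ∀ x y z → x * y * z ≡ y * (x * z)
  x*y*z≡y*[x*z] = solve-∀
  x*[y*z]≡y*[x*z] : ∀ x y z → x * (y * z) ≡ y * (x * z)
  x*[y*z]≡y*[x*z] = solve-∀

∸-suc : ∀ {p h} → p < h → h ∸ p ≡ suc (h ∸ suc p)
∸-suc p<h = +-∸-assoc 1 p<h

∑-pascal : ∀ g x (W : ℕ → ℕ) →
  ∑[ r ∈ upTo (suc (suc g)) ] (suc g C r) * x ^ r * W r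
  ≡ (∑[ r ∈ upTo (suc g) ] (g C r) * x ^ r * W r) + x * (∑[ r ∈ upTo (suc g) ] (g C r) * x ^ r * W (suc r))
∑-pascal g x W = begin
  ∑[ r ∈ upTo (suc (suc g)) ] (suc g C r) * x ^ r * W r
    ≡⟨ ∑-upTo-suc (suc g) (λ r → (suc g C r) * x ^ r * W r) ⟩
  f 0 + (∑[ r ∈ upTo (suc g) ] (suc g C suc r) * x ^ suc r * W (suc r))
    ≡⟨ cong (f 0 +_) (trans (∑-cong split (upTo (suc g))) (∑-+ (upTo (suc g)) (λ r → x * ((g C r) * x ^ r * W (suc r))) (λ r → f (suc r)))) ⟩
  f 0 + ((∑[ r ∈ upTo (suc g) ] x * ((g C r) * x ^ r * W (suc r))) + (∑[ r ∈ upTo (suc g) ] f (suc r)))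
    ≡⟨ cong (λ y → f 0 + (y + (∑[ r ∈ upTo (suc g) ] f (suc r)))) (∑-*ˡ x (upTo (suc g)) (λ r → (g C r) * x ^ r * W (suc r))) ⟩
  f 0 + (x * S + (∑[ r ∈ upTo (suc g) ] f (suc r)))
    ≡⟨ swap (f 0) (x * S) (∑[ r ∈ upTo (suc g) ] f (suc r)) ⟩
  f 0 + (∑[ r ∈ upTo (suc g) ] f (suc r)) + x * S
    ≡⟨ cong (_+ x * S) (trans (sym (∑-upTo-suc (suc g) f)) (∑-upTo-∷ʳ (suc g) f)) ⟩
  ∑ (upTo (suc g)) f + f (suc g) + x * S
    ≡⟨ cong (λ c → ∑ (upTo (suc g)) f + c * x ^ suc g * W (suc g) + x * S) (k>n⇒nCk≡0 (n<1+n g)) ⟩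
  ∑ (upTo (suc g)) f + 0 + x * S
    ≡⟨ cong (_+ x * S) (+-identityʳ _) ⟩
  ∑ (upTo (suc g)) f + x * S ∎
  where
  open ≡-Reasoning
  f : ℕ → ℕ
  f r = (g C r) * x ^ r * W r
  S = ∑[ r ∈ upTo (suc g) ] (g C r) * x ^ r * W (suc r)
  swap : ∀ a b c → a + (b + c) ≡ a + c + b
  swap = solve-∀
  distrib : ∀ a b x y w → (a + b) * (x * y) * w ≡ x * (a * y * w) + b * (x * y) * w
  distrib = solve-∀
  split : ∀ r → (suc g C suc r) * x ^ suc r * W (suc r) ≡ x * ((g C r) * x ^ r * W (suc r)) + f (suc r)
  split r = trans (cong (λ c → c * x ^ suc r * W (suc r)) (sym (nCk+nC[k+1]≡[n+1]C[k+1] g r)))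
                  (distrib (g C r) (g C suc r) x (x ^ r) (W (suc r)))

interval : ℕ → ℕ → List ℕ
interval p zero    = []
interval p (suc d) = suc p ∷ interval (suc p) d

interval-above : ∀ q d → All (q <_) (interval q d)
interval-above q zero    = []
interval-above q (suc d) = ≤-refl ∷ All.map (<-trans (n<1+n q)) (interval-above (suc q) d)

map-suc-upTo : ∀ m → map suc (upTo m) ≡ interval 0 m
map-suc-upTo zero    = refl
map-suc-upTo (suc m) = cong (1 ∷_) (begin
  map suc (applyUpTo suc m)      ≡⟨ cong (map suc) (map-upTo suc m) ⟨
  map suc (map suc (upTo m))     ≡⟨ cong (map suc) (map-suc-upTo m) ⟩
  map suc (interval 0 m)         ≡⟨ map-suc-interval 0 m ⟩
  interval 1 m                   ∎)
  where
  open ≡-Reasoning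
  map-suc-interval : ∀ p d → map suc (interval p d) ≡ interval (suc p) d
  map-suc-interval p zero    = refl
  map-suc-interval p (suc d) = cong (suc (suc p) ∷_) (map-suc-interval (suc p) d)

All-choose : ∀ {P : ℕ → Set} {xs} → All P xs → ∀ k → All (All P) (choose xs k)
All-choose _          zero    = [] ∷ []
All-choose []         (suc k) = []
All-choose (px ∷ pxs) (suc k) = ++⁺ (gmap⁺ (px ∷_) (All-choose pxs k)) (All-choose pxs (suc k))

module _ (n : ℕ) where

  -- For r = 0, j = 1 and G = (m₁(π), …, m_{k+1}(π)) this is the inner sum of the formula;
  -- r counts files already placed and gaps are numbered from j.
  fileWeight : ℕ → List ℕ → ℕ → ℕ → ℕ
  fileWeight r G j ℓ = ∑[ ρ ∈ boundedTuples G ] (if does (r + sum ρ ≟ ℓ) then prodTerm n j G ρ else 0)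

  fileWeight-∷ : ∀ g G j ℓ →
    fileWeight 0 (g ∷ G) j ℓ ≡ ∑[ r ∈ upTo (suc g) ] (g C r) * (n + 1 ∸ j) ^ r * fileWeight r G (suc j) ℓ
  fileWeight-∷ g G j ℓ = begin
    ∑ (concatMap (λ r → map (r ∷_) (boundedTuples G)) (upTo (suc g))) w
      ≡⟨ ∑-concatMap (λ r → map (r ∷_) (boundedTuples G)) (upTo (suc g)) w ⟩
    ∑[ r ∈ upTo (suc g) ] ∑ (map (r ∷_) (boundedTuples G)) w
      ≡⟨ ∑-cong (λ r → trans (∑-map (r ∷_) (boundedTuples G) w)
                      (trans (∑-cong (λ ρ → if-* (does (r + sum ρ ≟ ℓ)) (c r) (prodTerm n (suc j) G ρ)) (boundedTuples G))
                             (∑-*ˡ (c r) (boundedTuples G) _))) (upTo (suc g)) ⟩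
    ∑[ r ∈ upTo (suc g) ] (g C r) * (n + 1 ∸ j) ^ r * fileWeight r G (suc j) ℓ ∎
    where
    open ≡-Reasoning
    w = λ ρ → if does (sum ρ ≟ ℓ) then prodTerm n j (g ∷ G) ρ else 0
    c = λ r → (g C r) * (n + 1 ∸ j) ^ r
    if-* : ∀ b a c → (if b then a * c else 0) ≡ a * (if b then c else 0)
    if-* true  a c = refl
    if-* false a c = sym (*-zeroʳ a)

  fileWeight-0∷ : ∀ G j ℓ → fileWeight 0 (0 ∷ G) j ℓ ≡ fileWeight 0 G (suc j) ℓ
  fileWeight-0∷ G j ℓ = trans (fileWeight-∷ 0 G j ℓ) (trans (+-identityʳ _) (*-identityˡ _))

  fileWeight-pascal : ∀ g G j ℓ →
    fileWeight 0 (suc g ∷ G) j ℓ ≡ fileWeight 0 (g ∷ G) j ℓ + (n + 1 ∸ j) * shift 1 (fileWeight 0 (g ∷ G) j) ℓ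
  fileWeight-pascal g G j ℓ = begin
    fileWeight 0 (suc g ∷ G) j ℓ
      ≡⟨ fileWeight-∷ (suc g) G j ℓ ⟩
    ∑[ r ∈ upTo (suc (suc g)) ] (suc g C r) * x ^ r * W r
      ≡⟨ ∑-pascal g x W ⟩
    (∑[ r ∈ upTo (suc g) ] (g C r) * x ^ r * W r) + x * (∑[ r ∈ upTo (suc g) ] (g C r) * x ^ r * W (suc r))
      ≡⟨ cong₂ (λ a b → a + x * b) (sym (fileWeight-∷ g G j ℓ)) (oneFileLess ℓ) ⟩
    fileWeight 0 (g ∷ G) j ℓ + x * shift 1 (fileWeight 0 (g ∷ G) j) ℓ ∎
    where
    open ≡-Reasoning
    x = n + 1 ∸ j
    W = λ r → fileWeight r G (suc j) ℓ
    oneFileLess : ∀ ℓ → ∑[ r ∈ upTo (suc g) ] (g C r) * x ^ r * fileWeight (suc r) G (suc j) ℓ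
                      ≡ shift 1 (fileWeight 0 (g ∷ G) j) ℓ
    oneFileLess zero    = trans (∑-cong (λ r → trans (cong ((g C r) * x ^ r *_) (∑-zero (boundedTuples G))) (*-zeroʳ ((g C r) * x ^ r)))
                                        (upTo (suc g)))
                                (∑-zero (upTo (suc g)))
    oneFileLess (suc ℓ) = sym (fileWeight-∷ g G j ℓ)

  -- The outer sum without the factor k! C(n, k), for the columns p + 1, …, p + d of R_{M,n}.
  gapSum : (M p d j k ℓ : ℕ) → ℕ
  gapSum M p d j k ℓ = ∑[ π ∈ choose (interval p d) k ] fileWeight 0 (gapsFrom M p π) j ℓ

  fileWeight-firstGap-suc : ∀ M p π j ℓ → p < M → All (suc p <_) π →
    fileWeight 0 (gapsFrom M p π) j ℓ
    ≡ fileWeight 0 (gapsFrom M (suc p) π) j ℓ + (n + 1 ∸ j) * shift 1 (fileWeight 0 (gapsFrom M (suc p) π) j) ℓ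
  fileWeight-firstGap-suc M p []      j ℓ p<M []
    rewrite ∸-suc p<M = fileWeight-pascal (M ∸ suc p) [] j ℓ
  fileWeight-firstGap-suc M p (h ∷ π) j ℓ p<M (1+p<h ∷ _)
    rewrite ∸-suc (<⇒≤ 1+p<h) | ∸-suc 1+p<h = fileWeight-pascal (h ∸ suc (suc p)) (gapsFrom M h π) j ℓ

  gapSum-rookFirst : ∀ M p d j k ℓ →
    ∑[ π ∈ choose (interval (suc p) d) k ] fileWeight 0 (gapsFrom M p (suc p ∷ π)) j ℓ ≡ gapSum M (suc p) d (suc j) k ℓ
  gapSum-rookFirst M p d j k ℓ = ∑-cong (λ π → trans (cong (λ g → fileWeight 0 (g ∷ gapsFrom M (suc p) π) j ℓ) noGap)
                                                  (fileWeight-0∷ (gapsFrom M (suc p) π) j ℓ))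
                                     (choose (interval (suc p) d) k)
    where
    noGap : suc p ∸ p ∸ 1 ≡ 0
    noGap = cong (_∸ 1) (m+n∸n≡m 1 p)

  gapSum-noRookFirst : ∀ M p d j k ℓ → p < M →
    ∑[ π ∈ choose (interval (suc p) d) k ] fileWeight 0 (gapsFrom M p π) j ℓ
    ≡ gapSum M (suc p) d j k ℓ + (n + 1 ∸ j) * shift 1 (gapSum M (suc p) d j k) ℓ
  gapSum-noRookFirst M p d j k ℓ p<M = begin
    ∑[ π ∈ πs ] fileWeight 0 (gapsFrom M p π) j ℓ
      ≡⟨ ∑-congᴬ (All.map (λ {π} → fileWeight-firstGap-suc M p π j ℓ p<M) (All-choose (interval-above (suc p) d) k)) ⟩
    ∑[ π ∈ πs ] (F π ℓ + x * shift 1 (F π) ℓ)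
      ≡⟨ ∑-+ πs (λ π → F π ℓ) (λ π → x * shift 1 (F π) ℓ) ⟩
    gapSum M (suc p) d j k ℓ + (∑[ π ∈ πs ] x * shift 1 (F π) ℓ)
      ≡⟨ cong (gapSum M (suc p) d j k ℓ +_) (trans (∑-*ˡ x πs (λ π → shift 1 (F π) ℓ)) (cong (x *_) (∑-shift πs F 1 ℓ))) ⟩
    gapSum M (suc p) d j k ℓ + x * shift 1 (gapSum M (suc p) d j k) ℓ ∎
    where
    open ≡-Reasoning
    πs = choose (interval (suc p) d) k
    x = n + 1 ∸ j
    F = λ π → fileWeight 0 (gapsFrom M (suc p) π) j

  rookFactor-suc : ∀ i k → suc k ! * ((n ∸ i) C suc k) ≡ (n ∸ i) * (k ! * ((n ∸ suc i) C k))
  rookFactor-suc i k = trans ([k+1]!*nC[k+1]≡n*k!*[n∸1]Ck (n ∸ i) k)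
                             (cong (λ N → (n ∸ i) * (k ! * (N C k))) (pred[m∸n]≡m∸[1+n] n i))

  weighted-rookFirst : ∀ M p d i k ℓ →
    k ! * ((n ∸ suc i) C k) * gapSum M (suc p) d (suc (suc i)) k ℓ ≡ placements n d (suc i) k ℓ →
    suc k ! * ((n ∸ i) C suc k) * (∑[ π ∈ choose (interval (suc p) d) k ] fileWeight 0 (gapsFrom M p (suc p ∷ π)) (suc i) ℓ)
    ≡ (n ∸ i) * placements n d (suc i) k ℓ
  weighted-rookFirst M p d i k ℓ weighted = begin
    suc k ! * ((n ∸ i) C suc k) * (∑[ π ∈ choose (interval (suc p) d) k ] fileWeight 0 (gapsFrom M p (suc p ∷ π)) (suc i) ℓ)
      ≡⟨ cong₂ _*_ (rookFactor-suc i k) (gapSum-rookFirst M p d (suc i) k ℓ) ⟩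
    (n ∸ i) * (k ! * ((n ∸ suc i) C k)) * G
      ≡⟨ *-assoc (n ∸ i) _ G ⟩
    (n ∸ i) * (k ! * ((n ∸ suc i) C k) * G)
      ≡⟨ cong ((n ∸ i) *_) weighted ⟩
    (n ∸ i) * placements n d (suc i) k ℓ ∎
    where
    open ≡-Reasoning
    G = gapSum M (suc p) d (suc (suc i)) k ℓ

  weighted-noRookFirst : ∀ W M p d i k ℓ → p < M →
    (∀ ℓ′ → W * gapSum M (suc p) d (suc i) k ℓ′ ≡ placements n d i k ℓ′) →
    W * (∑[ π ∈ choose (interval (suc p) d) k ] fileWeight 0 (gapsFrom M p π) (suc i) ℓ)
    ≡ placements n d i k ℓ + (n ∸ i) * shift 1 (placements n d i k) ℓ
  weighted-noRookFirst W M p d i k ℓ p<M weighted = begin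
    W * (∑[ π ∈ choose (interval (suc p) d) k ] fileWeight 0 (gapsFrom M p π) (suc i) ℓ)
      ≡⟨ cong (W *_) (gapSum-noRookFirst M p d (suc i) k ℓ p<M) ⟩
    W * (P ℓ + x * shift 1 P ℓ)
      ≡⟨ distrib W (P ℓ) x (shift 1 P ℓ) ⟩
    W * P ℓ + x * (W * shift 1 P ℓ)
      ≡⟨ cong₂ (λ a b → a + x * b) (weighted ℓ) (trans (*-shift W P 1 ℓ) (shift-cong weighted 1 ℓ)) ⟩
    placements n d i k ℓ + x * shift 1 (placements n d i k) ℓ
      ≡⟨ cong (λ y → placements n d i k ℓ + y * shift 1 (placements n d i k) ℓ) (cong (_∸ suc i) (+-comm n 1)) ⟩
    placements n d i k ℓ + (n ∸ i) * shift 1 (placements n d i k) ℓ ∎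
    where
    open ≡-Reasoning
    x = n + 1 ∸ suc i
    P = gapSum M (suc p) d (suc i) k
    distrib : ∀ w a x s → w * (a + x * s) ≡ w * a + x * (w * s)
    distrib = solve-∀

  weighted-gapSum≡placements : ∀ d p M i k ℓ → p + d ≡ M →
    k ! * ((n ∸ i) C k) * gapSum M p d (suc i) k ℓ ≡ placements n d i k ℓ
  weighted-gapSum≡placements zero    p _ i zero    ℓ refl rewrite m+n∸m≡n p 0 = oneGap ℓ
    where
    oneGap : ∀ ℓ → 1 * (fileWeight 0 (0 ∷ []) (suc i) ℓ + 0) ≡ placements n 0 i 0 ℓ
    oneGap zero    = refl
    oneGap (suc ℓ) = refl
  weighted-gapSum≡placements zero    p _ i (suc k) ℓ _    = *-zeroʳ (suc k ! * ((n ∸ i) C suc k))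
  weighted-gapSum≡placements (suc d) p _ i zero    ℓ refl = begin
    1 * (∑[ π ∈ choose (interval (suc p) d) 0 ] fileWeight 0 (gapsFrom M p π) (suc i) ℓ)
      ≡⟨ weighted-noRookFirst 1 M p d i 0 ℓ (m<m+n p z<s) (λ ℓ′ → weighted-gapSum≡placements d (suc p) M i 0 ℓ′ (sym (+-suc p d))) ⟩
    placements n d i 0 ℓ + (n ∸ i) * shift 1 (placements n d i 0) ℓ
      ≡⟨ cong (λ z → z + (n ∸ i) * shift 1 (placements n d i 0) ℓ) (sym (trans (cong (placements n d i 0 ℓ +_) (*-zeroʳ (n ∸ i))) (+-identityʳ _))) ⟩
    placements n (suc d) i 0 ℓ ∎
    where
    open ≡-Reasoning
    M = p + suc d
  weighted-gapSum≡placements (suc d) p _ i (suc k) ℓ refl = begin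
    W * (∑ (map (suc p ∷_) (choose I k) ++ choose I (suc k)) F)
      ≡⟨ cong (W *_) (∑-++ (map (suc p ∷_) (choose I k)) (choose I (suc k)) F) ⟩
    W * (∑ (map (suc p ∷_) (choose I k)) F + (∑[ π ∈ choose I (suc k) ] F π))
      ≡⟨ *-distribˡ-+ W _ _ ⟩
    W * ∑ (map (suc p ∷_) (choose I k)) F + W * (∑[ π ∈ choose I (suc k) ] F π)
      ≡⟨ cong₂ _+_ (trans (cong (W *_) (∑-map (suc p ∷_) (choose I k) F))
                          (weighted-rookFirst M p d i k ℓ (weighted (suc i) k ℓ)))
                   (weighted-noRookFirst W M p d i (suc k) ℓ (m<m+n p z<s) (weighted i (suc k))) ⟩
    (n ∸ i) * placements n d (suc i) k ℓ + (placements n d i (suc k) ℓ + (n ∸ i) * shift 1 (placements n d i (suc k)) ℓ)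
      ≡⟨ reorder ((n ∸ i) * placements n d (suc i) k ℓ) (placements n d i (suc k) ℓ) _ ⟩
    placements n (suc d) i (suc k) ℓ ∎
    where
    open ≡-Reasoning
    M = p + suc d
    I = interval (suc p) d
    F = λ π → fileWeight 0 (gapsFrom M p π) (suc i) ℓ
    W = suc k ! * ((n ∸ i) C suc k)
    weighted : ∀ i k ℓ → k ! * ((n ∸ i) C k) * gapSum M (suc p) d (suc i) k ℓ ≡ placements n d i k ℓ
    weighted i k ℓ = weighted-gapSum≡placements d (suc p) M i k ℓ (sym (+-suc p d))
    reorder : ∀ a b c → a + (b + c) ≡ b + a + c
    reorder = solve-∀

rhs≡placements : ∀ k ℓ m n → rhs k ℓ m n ≡ placements n m 0 k ℓ
rhs≡placements k ℓ m n = begin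
  rhs k ℓ m n
    ≡⟨ ∑-cong (λ π → trans (∑-*ˡ c (WC m ℓ π) (prodTerm n 1 (gaps m π)))
                           (cong (c *_) (∑-filter (λ ρ → sum ρ ≟ ℓ) (boundedTuples (gaps m π)) (prodTerm n 1 (gaps m π)))))
              (Ck k m) ⟩
  ∑[ π ∈ Ck k m ] c * fileWeight n 0 (gaps m π) 1 ℓ
    ≡⟨ ∑-*ˡ c (Ck k m) (λ π → fileWeight n 0 (gaps m π) 1 ℓ) ⟩
  c * (∑[ π ∈ choose (map suc (upTo m)) k ] fileWeight n 0 (gaps m π) 1 ℓ)
    ≡⟨ cong (λ ps → c * (∑[ π ∈ choose ps k ] fileWeight n 0 (gaps m π) 1 ℓ)) (map-suc-upTo m) ⟩
  c * gapSum n m 0 m 1 k ℓ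
    ≡⟨ weighted-gapSum≡placements n m 0 m 0 k ℓ refl ⟩
  placements n m 0 k ℓ ∎
  where
  open ≡-Reasoning
  c = k ! * (n C k)

proposition2p17 : (m n k ℓ : ℕ) → 1 ≤ m → 1 ≤ n → numM k ℓ m n ≡ rhs k ℓ m n
proposition2p17 m n k ℓ _ _ = trans (numM≡placements k ℓ m n) (sym (rhs≡placements k ℓ m n))
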